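{- Let $\mathcal{M}$ be a minimal criminal. Then: (1) $\mathcal{M}$ is strongly connected. (2) For each $u\in V(\mathcal{M})$, $A_s(u)\in\{1,2\}$. (3) For every edge $e=(u,v)\in E(\mathcal{M})$, for all but at most one element $w$ of $\{v\}\cup N_1(v)$ there is a directed path of length 1 or 2 from $u$ to $w$ in $\mathcal{M}$ that does not use the edge $e$. (4) Every edge of $\mathcal{M}$ is the base of a transitive triangle or a base of a 2-directed diamond. (5) If $e=(u,v)\in E(\mathcal{M})$ and $|N_1(u)|\le |N_1(v)|$, then $e$ is the base of at least $|N_1(v)|-|N_1(u)|+1$ transitive triangles and a base of at least $|N_1(v)|-|N_1(u)|+1$ 2-directed diamonds. (6) For every vertex $u\in V(\mathcal{M})$ there exists $v\in N_{ -1}(u)$ with $A_s(v)=1$. (7) There is a directed cycle in $\mathcal{M}$ all of whose vertices $w$ satisfy $A_s(w)=1$.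
   Context: All digraphs are finite, nonempty, with no loops, no multiple edges and no digons (if $(u,v)\in E$ then $(v,u)\notin E$). For a vertex $u$ and positive integer $i$, $N_i(u)=\{v : \mathrm{dist}(u,v)=i\}$ and $N_{ -i}(u)=\{v:\mathrm{dist}(v,u)=i\}$, where $\mathrm{dist}(u,v)$ is the length of a shortest directed path from $u$ to $v$ ($\infty$ if none). A vertex $u$ is satisfactory if $|N_1(u)|\le|N_2(u)|$; the anti-satisfaction of $u$ is $A_s(u)=|N_1(u)|-|N_2(u)|$. Let $\mathcal{A}$ be the set of such digraphs having no satisfactory vertex, $\mathcal{A}'$ the set of members of $\mathcal{A}$ with the minimum number of edges among members of $\mathcal{A}$, and $\mathcal{A}''$ the set of members of $\mathcal{A}'$ with the minimum number of vertices among members of $\mathcal{A}'$. A minimal criminal is an element of $\mathcal{A}''$. A transitive triangle with base $(u,v)$ is a triple $u,v,w$ with $(u,v),(u,w),(v,w)$ edges; so the number of transitive triangles with base $(u,v)$ is $|N_1(u)\cap N_1(v)|$, and $(u,v)$ is the base of a transitive triangle iff $N_1(u)\cap N_1(v)\neq\emptyset$. For distinct vertices $t,u,v,w$ with $(t,u),(u,w),(t,v),(v,w)$ all edges, the edge set $\{(t,u),(u,w),(t,v),(v,w)\}$ is a 2-directed diamond, whose bases are the edges $(t,u)$ and $(t,v)$. -}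

module Defs where

open import Data.Bool using (Bool; true; false; T)
open import Data.Bool.Properties using (T?)
open import Data.Nat using (ℕ; zero; suc; _≤_; _<_; _+_; _∸_)
open import Data.Fin using (Fin; toℕ)
open import Data.Fin.Properties using (any?; all?) renaming (_≟_ to _≟ᶠ_)
open import Data.List using (List; []; _∷_; _++_; length; filter; allFin; map)
open import Data.Nat.ListAction using (sum)
import Level
open import Data.List.Relation.Unary.All using (All)
open import Data.List.Relation.Unary.Unique.Propositional using (Unique)
open import Data.Integer using (ℤ; +_; _-_)
open import Data.Product using (Σ; ∃; _×_; _,_)
open import Data.Sum using (_⊎_)
open import Data.Unit using (⊤)
open import Data.Empty using (⊥)
open import Relation.Nullary using (¬_; Dec; yes; no; _×-dec_; ¬?)
open import Relation.Unary using (Pred; Decidable)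
open import Relation.Binary.PropositionalEquality using (_≡_; _≢_)

record Digraph : Set where
  field
    n        : ℕ
    adj      : Fin n → Fin n → Bool
    nonempty : 1 ≤ n
    noLoop   : ∀ u → ¬ T (adj u u)
    noDigon  : ∀ u v → T (adj u v) → ¬ T (adj v u)

module _ (G : Digraph) where
  open Digraph G

  V : Set
  V = Fin n

  Edge : V → V → Set
  Edge u v = T (adj u v)

  edge? : ∀ u v → Dec (Edge u v)
  edge? u v = T? (adj u v)

  card : {P : Pred V Level.zero} → Decidable P → ℕ
  card P? = length (filter P? (allFin n))

  numEdges : ℕ
  numEdges = sum (map (λ u → card (edge? u)) (allFin n))

  Walk : ℕ → V → V → Set
  Walk zero    u v = u ≡ v
  Walk (suc k) u v = Σ V (λ w → Edge u w × Walk k w v)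

  walk? : ∀ k u v → Dec (Walk k u v)
  walk? zero    u v = u ≟ᶠ v
  walk? (suc k) u v = any? (λ w → edge? u w ×-dec walk? k w v)

  Dist : V → V → ℕ → Set
  Dist u v i = Walk i u v × ((j : Fin i) → ¬ Walk (toℕ j) u v)

  dist? : ∀ u v i → Dec (Dist u v i)
  dist? u v i = walk? i u v ×-dec all? (λ j → ¬? (walk? (toℕ j) u v))

  Nout : ℕ → V → Pred V Level.zero
  Nout i u v = Dist u v i

  Nin : ℕ → V → Pred V Level.zero
  Nin i u v = Dist v u i

  degOut : ℕ → V → ℕ
  degOut i u = card (λ v → dist? u v i)

  Satisfactory : V → Set
  Satisfactory u = degOut 1 u ≤ degOut 2 u

  As : V → ℤ
  As u = + degOut 1 u - + degOut 2 u

  StronglyConnected : Set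
  StronglyConnected = ∀ u v → ∃ λ k → Walk k u v

  NotEdge : V → V → V → V → Set
  NotEdge a b x y = ¬ (x ≡ a × y ≡ b)

  ShortPathAvoiding : V → V → V → V → Set
  ShortPathAvoiding a b u w =
      (Edge u w × NotEdge a b u w)
    ⊎ Σ V (λ x → Edge u x × Edge x w × NotEdge a b u x × NotEdge a b x w
                 × u ≢ x × x ≢ w × u ≢ w)

  -- transitive triangles with base (u,v): the w in N_1(u) ∩ N_1(v)
  TriangleApex : V → V → Pred V Level.zero
  TriangleApex u v w = Nout 1 u w × Nout 1 v w

  triangleApex? : ∀ u v → Decidable (TriangleApex u v)
  triangleApex? u v w = dist? u w 1 ×-dec dist? v w 1

  numTriangles : V → V → ℕ
  numTriangles u v = card (triangleApex? u v)

  -- 2-directed diamonds with base (a,b): the diamond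
  -- {(a,b),(b,w),(a,c),(c,w)} with a,b,c,w distinct is determined by (c,w).
  Diamond : V → V → V → V → Set
  Diamond a b c w =
    Edge a b × Edge b w × Edge a c × Edge c w
    × a ≢ b × a ≢ c × a ≢ w × b ≢ c × b ≢ w × c ≢ w

  diamond? : ∀ a b c w → Dec (Diamond a b c w)
  diamond? a b c w =
    edge? a b ×-dec edge? b w ×-dec edge? a c ×-dec edge? c w
    ×-dec ¬? (a ≟ᶠ b) ×-dec ¬? (a ≟ᶠ c) ×-dec ¬? (a ≟ᶠ w)
    ×-dec ¬? (b ≟ᶠ c) ×-dec ¬? (b ≟ᶠ w) ×-dec ¬? (c ≟ᶠ w)

  IsDiamondBase : V → V → Set
  IsDiamondBase a b = Σ V (λ c → Σ V (λ w → Diamond a b c w))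

  numDiamonds : V → V → ℕ
  numDiamonds a b = sum (map (λ c → card (diamond? a b c)) (allFin n))

  EdgesAlong : List V → Set
  EdgesAlong []            = ⊤
  EdgesAlong (x ∷ [])      = ⊤
  EdgesAlong (x ∷ y ∷ xs)  = Edge x y × EdgesAlong (y ∷ xs)

  IsCycle : List V → Set
  IsCycle []       = ⊥
  IsCycle (x ∷ xs) = Unique (x ∷ xs) × 1 ≤ length xs × EdgesAlong (x ∷ xs ++ x ∷ [])

InA : Digraph → Set
InA G = ∀ u → ¬ Satisfactory G u

InA′ : Digraph → Set
InA′ G = InA G × (∀ H → InA H → numEdges G ≤ numEdges H)

MinimalCriminal : Digraph → Set
MinimalCriminal G = InA′ G × (∀ H → InA′ H → Digraph.n G ≤ Digraph.n H)

module Submission where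

-- The whole proof rests on two reductions that produce smaller digraphs:
--  * Edge deletion.  Deleting a set D of edges keeps |N₁(y)| and can only
--    shrink |N₂(y)| at every vertex y none of whose out-edges lies in D.  As
--    G has the fewest edges in 𝒜, the smaller digraph has a satisfactory
--    vertex, which must therefore be the tail of a deleted edge.
--  * Induced subdigraphs.  On a proper forward-closed vertex set all
--    distances are unchanged, so the induced subdigraph would be a member of
--    𝒜 with no more edges and fewer vertices; hence no such set exists.
-- Deleting a single edge (u,v) gives |N₁(u)| ≤ 1 + |N₂(u)| in G − e, and
-- comparing N₂(u) before and after the deletion shows that at most one
-- second neighbour is lost; (2)–(5) follow by counting.  The second
-- reduction, applied to the vertices reachable from a vertex, gives (1).
-- Deleting all edges into u gives (6), and walking backwards along (6) until
-- a vertex repeats gives (7).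

open import Defs
open import Data.Bool using (Bool; true; false; T; _∧_; not)
open import Data.Unit using (tt)
open import Data.Empty using (⊥; ⊥-elim)
open import Data.Nat using (ℕ; zero; suc; _≤_; _<_; _+_; _∸_; z≤n; s≤s; _≤?_; _<?_)
open import Data.Nat.Properties
open import Data.Nat.ListAction using (sum)
open import Data.Nat.Solver using (module +-*-Solver)
open import Data.Integer using (+_; _-_)
open import Data.Integer.Properties using ([+m]-[+n]≡m⊖n; ⊖-≥)
open import Data.Fin using (Fin; zero; suc; toℕ; inject₁; fromℕ<)
open import Data.Fin.Properties using (any?; pigeonhole; toℕ-inject₁) renaming (_≟_ to _≟ᶠ_)
import Data.Fin.Properties as Fin
open import Data.List using (List; []; _∷_; _++_; length; filter; map; allFin; lookup)
open import Data.List.Properties using (map-tabulate; tabulate-lookup; map-∘; length-tabulate; length-filter; filter-notAll)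
open import Data.List.Membership.Propositional using (_∈_; lose)
open import Data.List.Membership.Propositional.Properties using (∈-allFin; ∈-filter⁺; ∈-filter⁻; ∈-lookup)
open import Data.List.Relation.Unary.All using (All; []; _∷_)
import Data.List.Relation.Unary.All as All
open import Data.List.Relation.Unary.All.Properties using (¬Any⇒All¬)
open import Data.List.Relation.Unary.Any using (here; there; index)
import Data.List.Relation.Unary.Any as Any
open import Data.List.Relation.Unary.Any.Properties using (lookup-index)
open import Data.List.Relation.Unary.AllPairs using (AllPairs; []; _∷_)
open import Data.List.Relation.Unary.Unique.Propositional using (Unique)
open import Data.List.Relation.Unary.Unique.Propositional.Properties using (allFin⁺; filter⁺)
open import Function using (_∘_)
open import Data.Product using (Σ; ∃; _×_; _,_; proj₁; proj₂)
open import Data.Sum using (_⊎_; inj₁; inj₂; [_,_]′) renaming (map to map⊎)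
open import Relation.Nullary using (¬_; Dec; yes; no; does; _×-dec_; _⊎-dec_; ¬?)
open import Relation.Nullary.Decidable using (decidable-stable)
open import Relation.Unary using (Decidable)
open import Relation.Binary.PropositionalEquality
  using (_≡_; _≢_; refl; sym; trans; cong; subst; subst₂; module ≡-Reasoning)

-- Counting elements of a list satisfying a decidable predicate.
-- Every cardinality in Defs (card, degOut, numTriangles) is such a count
-- over allFin n.

count : {A : Set} {P : A → Set} → Decidable P → List A → ℕ
count P? xs = length (filter P? xs)

module _ {A : Set} where

  count-mono : {P Q : A → Set} (P? : Decidable P) (Q? : Decidable Q) →
               (∀ x → P x → Q x) → ∀ xs → count P? xs ≤ count Q? xs
  count-mono P? Q? P⇒Q [] = z≤n
  count-mono P? Q? P⇒Q (x ∷ xs) with P? x | Q? x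
  ... | yes _ | yes _ = s≤s (count-mono P? Q? P⇒Q xs)
  ... | yes p | no ¬q = ⊥-elim (¬q (P⇒Q x p))
  ... | no _  | yes _ = m≤n⇒m≤1+n (count-mono P? Q? P⇒Q xs)
  ... | no _  | no _  = count-mono P? Q? P⇒Q xs

  count-ext : {P Q : A → Set} (P? : Decidable P) (Q? : Decidable Q) →
              (∀ x → P x → Q x) → (∀ x → Q x → P x) → ∀ xs → count P? xs ≡ count Q? xs
  count-ext P? Q? P⇒Q Q⇒P xs = ≤-antisym (count-mono P? Q? P⇒Q xs) (count-mono Q? P? Q⇒P xs)

  count-split : {P Q : A → Set} (P? : Decidable P) (Q? : Decidable Q) → ∀ xs →
     count P? xs ≡ count (λ x → P? x ×-dec Q? x) xs + count (λ x → P? x ×-dec ¬? (Q? x)) xs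
  count-split P? Q? [] = refl
  count-split P? Q? (x ∷ xs) with P? x | Q? x
  ... | yes _ | yes _ = cong suc (count-split P? Q? xs)
  ... | yes _ | no _  = trans (cong suc (count-split P? Q? xs))
                              (sym (+-suc (count (λ x → P? x ×-dec Q? x) xs) _))
  ... | no _  | yes _ = count-split P? Q? xs
  ... | no _  | no _  = count-split P? Q? xs

  count-union : {P Q R : A → Set} (P? : Decidable P) (Q? : Decidable Q) (R? : Decidable R) →
     (∀ x → P x → Q x ⊎ R x) → ∀ xs → count P? xs ≤ count Q? xs + count R? xs
  count-union P? Q? R? cover [] = z≤n
  count-union P? Q? R? cover (x ∷ xs)
    with count-union P? Q? R? cover xs | P? x | Q? x | R? x
  ... | ih | yes _ | yes _ | yes _ = s≤s (≤-trans ih (+-monoʳ-≤ (count Q? xs) (n≤1+n _)))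
  ... | ih | yes _ | yes _ | no _  = s≤s ih
  ... | ih | yes _ | no _  | yes _ = ≤-trans (s≤s ih) (≤-reflexive (sym (+-suc (count Q? xs) (count R? xs))))
  ... | ih | yes p | no ¬q | no ¬r = ⊥-elim ([ ¬q , ¬r ]′ (cover x p))
  ... | ih | no _  | yes _ | yes _ = ≤-trans ih (+-mono-≤ (n≤1+n _) (n≤1+n _))
  ... | ih | no _  | yes _ | no _  = ≤-trans ih (+-monoˡ-≤ (count R? xs) (n≤1+n (count Q? xs)))
  ... | ih | no _  | no _  | yes _ = ≤-trans ih (+-monoʳ-≤ (count Q? xs) (n≤1+n _))
  ... | ih | no _  | no _  | no _  = ih

  count-pos : {P : A → Set} (P? : Decidable P) → ∀ {x xs} → x ∈ xs → P x → 1 ≤ count P? xs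
  count-pos P? {xs = y ∷ xs} (here refl) px with P? y
  ... | yes _ = s≤s z≤n
  ... | no ¬p = ⊥-elim (¬p px)
  count-pos P? {xs = y ∷ xs} (there x∈xs) px with P? y
  ... | yes _ = s≤s z≤n
  ... | no _  = count-pos P? x∈xs px

  count-witness : {P : A → Set} (P? : Decidable P) → ∀ xs → 1 ≤ count P? xs → Σ A P
  count-witness P? (x ∷ xs) pos with P? x
  ... | yes p = x , p
  ... | no _  = count-witness P? xs pos

  count-none : {P : A → Set} (P? : Decidable P) → ∀ xs → All (λ x → ¬ P x) xs → count P? xs ≡ 0
  count-none P? [] [] = refl
  count-none P? (x ∷ xs) (¬px ∷ rest) with P? x
  ... | yes p = ⊥-elim (¬px p)
  ... | no _  = count-none P? xs rest

  count-atMostOne : {P : A → Set} (P? : Decidable P) (y : A) → ∀ xs → Unique xs →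
                    (∀ x → P x → x ≡ y) → count P? xs ≤ 1
  count-atMostOne P? y [] _ only = z≤n
  count-atMostOne P? y (x ∷ xs) (x∉xs ∷ uniq) only with P? x
  ... | yes px = s≤s (≤-reflexive (count-none P? xs
                   (All.map (λ {z} x≢z pz → x≢z (trans (only x px) (sym (only z pz)))) x∉xs)))
  ... | no _   = count-atMostOne P? y xs uniq only

  count-strict : {P Q : A → Set} (P? : Decidable P) (Q? : Decidable Q) →
     (∀ x → P x → Q x) → ∀ {x xs} → x ∈ xs → Q x → ¬ P x → count P? xs < count Q? xs
  count-strict P? Q? P⇒Q {x} {xs} x∈xs qx ¬px = begin-strict
      count P? xs
        <⟨ m<n+m (count P? xs) (count-pos (λ z → Q? z ×-dec ¬? (P? z)) x∈xs (qx , ¬px)) ⟩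
      count (λ z → Q? z ×-dec ¬? (P? z)) xs + count P? xs
        ≡⟨ +-comm _ (count P? xs) ⟩
      count P? xs + count (λ z → Q? z ×-dec ¬? (P? z)) xs
        ≤⟨ +-monoˡ-≤ _ (count-mono P? (λ z → Q? z ×-dec P? z) (λ z p → P⇒Q z p , p) xs) ⟩
      count (λ z → Q? z ×-dec P? z) xs + count (λ z → Q? z ×-dec ¬? (P? z)) xs
        ≡⟨ count-split Q? P? xs ⟨
      count Q? xs ∎
    where open ≤-Reasoning

  count-two : {P : A → Set} (P? : Decidable P) (_≟_ : (a b : A) → Dec (a ≡ b)) →
              ∀ {x y xs} → x ∈ xs → y ∈ xs → x ≢ y → P x → P y → 2 ≤ count P? xs
  count-two P? _≟_ {x} {y} {xs} x∈xs y∈xs x≢y px py = begin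
      2 ≤⟨ +-mono-≤ (count-pos (λ z → P? z ×-dec (z ≟ x)) x∈xs (px , refl))
                    (count-pos (λ z → P? z ×-dec ¬? (z ≟ x)) y∈xs (py , λ y≡x → x≢y (sym y≡x))) ⟩
      _ ≡⟨ count-split P? (λ z → z ≟ x) xs ⟨
      count P? xs ∎
    where open ≤-Reasoning

  count-other : {P : A → Set} (P? : Decidable P) (_≟_ : (a b : A) → Dec (a ≡ b)) →
                ∀ xs → Unique xs → 2 ≤ count P? xs → (y : A) → Σ A (λ x → P x × x ≢ y)
  count-other P? _≟_ xs uniq two y =
    count-witness (λ z → P? z ×-dec ¬? (z ≟ y)) xs (≤-pred (begin
      2 ≤⟨ two ⟩
      count P? xs ≡⟨ count-split P? (λ z → z ≟ y) xs ⟩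
      count (λ z → P? z ×-dec (z ≟ y)) xs + count (λ z → P? z ×-dec ¬? (z ≟ y)) xs
        ≤⟨ +-monoˡ-≤ _ (count-atMostOne (λ z → P? z ×-dec (z ≟ y)) y xs uniq (λ _ → proj₂)) ⟩
      1 + count (λ z → P? z ×-dec ¬? (z ≟ y)) xs ∎))
    where open ≤-Reasoning

  count-map : {B : Set} {P : B → Set} (P? : Decidable P) (f : A → B) → ∀ xs →
              count P? (map f xs) ≡ count (λ x → P? (f x)) xs
  count-map P? f [] = refl
  count-map P? f (x ∷ xs) with P? (f x)
  ... | yes _ = cong suc (count-map P? f xs)
  ... | no _  = count-map P? f xs

  count-filter : {P S : A → Set} (P? : Decidable P) (S? : Decidable S) → ∀ xs →
                 count P? (filter S? xs) ≡ count (λ x → P? x ×-dec S? x) xs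
  count-filter P? S? [] = refl
  count-filter P? S? (x ∷ xs) with S? x
  ... | no _ with P? x
  ...   | yes _ = count-filter P? S? xs
  ...   | no _  = count-filter P? S? xs
  count-filter P? S? (x ∷ xs) | yes _ with P? x
  ...   | yes _ = cong suc (count-filter P? S? xs)
  ...   | no _  = count-filter P? S? xs

  sum-mono : (f g : A → ℕ) → (∀ x → f x ≤ g x) → ∀ xs → sum (map f xs) ≤ sum (map g xs)
  sum-mono f g f≤g [] = z≤n
  sum-mono f g f≤g (x ∷ xs) = +-mono-≤ (f≤g x) (sum-mono f g f≤g xs)

  sum-strict : (f g : A → ℕ) → (∀ x → f x ≤ g x) → ∀ {x xs} → x ∈ xs → f x < g x →
               sum (map f xs) < sum (map g xs)
  sum-strict f g f≤g {xs = y ∷ xs} (here refl) lt = +-mono-<-≤ lt (sum-mono f g f≤g xs)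
  sum-strict f g f≤g {xs = y ∷ xs} (there x∈xs) lt = +-mono-≤-< (f≤g y) (sum-strict f g f≤g x∈xs lt)

  sum-filter : (f : A → ℕ) {S : A → Set} (S? : Decidable S) → ∀ xs →
               sum (map f (filter S? xs)) ≤ sum (map f xs)
  sum-filter f S? [] = z≤n
  sum-filter f S? (x ∷ xs) with S? x
  ... | yes _ = +-monoʳ-≤ (f x) (sum-filter f S? xs)
  ... | no _  = ≤-trans (sum-filter f S? xs) (m≤n+m _ (f x))

count-any≤sum : {A C : Set} {P : C → A → Set} (P? : ∀ c w → Dec (P c w)) → ∀ cs ys →
   count (λ w → Any.any? (λ c → P? c w) cs) ys ≤ sum (map (λ c → count (P? c) ys) cs)
count-any≤sum P? [] ys = ≤-reflexive (count-none _ ys (All.tabulate (λ _ ())))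
count-any≤sum P? (c ∷ cs) ys = ≤-trans
  (count-union _ (P? c) (λ w → Any.any? (λ c → P? c w) cs)
     (λ { w (here p) → inj₁ p ; w (there q) → inj₂ q }) ys)
  (+-monoʳ-≤ (count (P? c) ys) (count-any≤sum P? cs ys))

count-allFin≤ : ∀ {n} {P : Fin n → Set} (P? : Decidable P) → count P? (allFin n) ≤ n
count-allFin≤ {n} P? = subst (count P? (allFin n) ≤_) (length-tabulate (λ x → x)) (length-filter P? (allFin n))

lookup-injective : {A : Set} (xs : List A) → Unique xs → ∀ i j → lookup xs i ≡ lookup xs j → i ≡ j
lookup-injective (x ∷ xs) _ zero zero _ = refl
lookup-injective (x ∷ xs) (x∉xs ∷ _) zero (suc j) eq = ⊥-elim (All.lookup x∉xs (∈-lookup j) eq)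
lookup-injective (x ∷ xs) (x∉xs ∷ _) (suc i) zero eq = ⊥-elim (All.lookup x∉xs (∈-lookup i) (sym eq))
lookup-injective (x ∷ xs) (_ ∷ uniq) (suc i) (suc j) eq = cong suc (lookup-injective xs uniq i j eq)

unique-length≤ : ∀ {n} (xs : List (Fin n)) → Unique xs → length xs ≤ n
unique-length≤ {n} xs uniq with n <? length xs
... | no ¬n<len = ≮⇒≥ ¬n<len
... | yes n<len with pigeonhole n<len (lookup xs)
...   | i , j , i<j , same = ⊥-elim (Fin.<⇒≢ i<j (lookup-injective xs uniq i j same))

module _ (G : Digraph) where
  open Digraph G

  dist1⇒edge : ∀ {a b} → Dist G a b 1 → Edge G a b
  dist1⇒edge ((_ , e , refl) , _) = e

  edge⇒dist1 : ∀ {a b} → Edge G a b → Dist G a b 1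
  edge⇒dist1 {a} e = (_ , e , refl) , λ { zero → λ { refl → noLoop a e } }

-- Deleting a decidable set D of edges.  A vertex is unaffected if none of its
-- out-edges is deleted; such a vertex keeps N₁ and does not gain second
-- neighbours, so it stays unsatisfied.
module EdgeDeletion (G : Digraph) {D : V G → V G → Set} (D? : ∀ a b → Dec (D a b)) where
  open Digraph G

  adj∖D : V G → V G → Bool
  adj∖D a b = adj a b ∧ not (does (D? a b))

  remaining-edge : ∀ {a b} → T (adj∖D a b) → Edge G a b × ¬ D a b
  remaining-edge {a} {b} e with adj a b | D? a b
  ... | true  | no ¬d = e , ¬d
  ... | true  | yes _ = ⊥-elim e
  ... | false | _     = ⊥-elim e

  keep-edge : ∀ {a b} → Edge G a b → ¬ D a b → T (adj∖D a b)
  keep-edge {a} {b} e ¬d with adj a b | D? a b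
  ... | true  | no _  = tt
  ... | true  | yes d = ⊥-elim (¬d d)
  ... | false | _     = ⊥-elim e

  G∖D : Digraph
  G∖D = record
    { n = n ; adj = adj∖D ; nonempty = nonempty
    ; noLoop  = λ u e → noLoop u (proj₁ (remaining-edge e))
    ; noDigon = λ u v e e′ → noDigon u v (proj₁ (remaining-edge e)) (proj₁ (remaining-edge e′)) }

  walk-lift : ∀ k a b → Walk G∖D k a b → Walk G k a b
  walk-lift zero    a b p           = p
  walk-lift (suc k) a b (w , e , p) = w , proj₁ (remaining-edge e) , walk-lift k w b p

  Unaffected : V G → Set
  Unaffected y = ∀ z → Edge G y z → ¬ D y z

  dist1-lift : ∀ {y w} → Dist G∖D y w 1 → Dist G y w 1
  dist1-lift (p , shorter) = walk-lift 1 _ _ p , λ { zero → shorter zero }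

  dist1-keep : ∀ {y w} → (Edge G y w → ¬ D y w) → Dist G y w 1 → Dist G∖D y w 1
  dist1-keep kept ((_ , e , refl) , shorter) = (_ , keep-edge e (kept e) , refl) , λ { zero → shorter zero }

  dist2-lift : ∀ {y w} → (Edge G y w → ¬ D y w) → Dist G∖D y w 2 → Dist G y w 2
  dist2-lift kept (p , shorter) = walk-lift 2 _ _ p ,
    λ { zero       → shorter zero
      ; (suc zero) → λ { (_ , e , refl) → shorter (suc zero) (_ , keep-edge e (kept e) , refl) } }

  degOut2-lift : ∀ y → (∀ w → Dist G∖D y w 2 → Edge G y w → ¬ D y w) →
                 degOut G∖D 2 y ≤ degOut G 2 y
  degOut2-lift y kept = count-mono (λ w → dist? G∖D y w 2) (λ w → dist? G y w 2)
                                   (λ w d → dist2-lift (kept w d) d) (allFin n)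

  degOut1-unaffected : ∀ y → Unaffected y → degOut G∖D 1 y ≡ degOut G 1 y
  degOut1-unaffected y kept = count-ext (λ w → dist? G∖D y w 1) (λ w → dist? G y w 1)
                                        (λ w → dist1-lift) (λ w → dist1-keep (kept w)) (allFin n)

  degOut1-single-target : ∀ y t → (∀ z → z ≢ t → ¬ D y z) → degOut G 1 y ≤ suc (degOut G∖D 1 y)
  degOut1-single-target y t kept = begin
      degOut G 1 y
        ≡⟨ count-split (λ w → dist? G y w 1) (λ w → w ≟ᶠ t) (allFin n) ⟩
      count (λ w → dist? G y w 1 ×-dec (w ≟ᶠ t)) (allFin n) + count (λ w → dist? G y w 1 ×-dec ¬? (w ≟ᶠ t)) (allFin n)
        ≤⟨ +-mono-≤ (count-atMostOne _ t (allFin n) (allFin⁺ n) (λ _ → proj₂))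
                    (count-mono _ (λ w → dist? G∖D y w 1) (λ w (d , w≢t) → dist1-keep (λ _ → kept w w≢t) d) (allFin n)) ⟩
      suc (degOut G∖D 1 y) ∎
    where open ≤-Reasoning

  unaffected-unsatisfied : ∀ y → Unaffected y → ¬ Satisfactory G y → ¬ Satisfactory G∖D y
  unaffected-unsatisfied y kept unsat sat =
    unsat (subst (_≤ degOut G 2 y) (degOut1-unaffected y kept) (≤-trans sat (degOut2-lift y (λ w _ → kept w))))

  fewer-edges : ∀ {a b} → Edge G a b → D a b → numEdges G∖D < numEdges G
  fewer-edges {a} {b} e d = sum-strict (λ x → card G∖D (edge? G∖D x)) (λ x → card G (edge? G x))
     (λ x → count-mono (edge? G∖D x) (edge? G x) (λ _ → proj₁ ∘ remaining-edge) (allFin n))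
     (∈-allFin a)
     (count-strict (edge? G∖D a) (edge? G a) (λ _ → proj₁ ∘ remaining-edge) (∈-allFin b) e (λ e′ → proj₂ (remaining-edge e′) d))

module Criminal (G : Digraph) (mc : MinimalCriminal G) where
  open Digraph G

  unsatisfied : ∀ u → degOut G 2 u < degOut G 1 u
  unsatisfied u = ≰⇒> (proj₁ (proj₁ mc) u)

  outNeighbour : ∀ u → Σ (V G) (Nout G 1 u)
  outNeighbour u = count-witness (λ w → dist? G u w 1) (allFin n) (≤-trans (s≤s z≤n) (unsatisfied u))

  another-outNeighbour : ∀ v → 1 ≤ degOut G 2 v → (y : V G) → Σ (V G) (λ z → Nout G 1 v z × z ≢ y)
  another-outNeighbour v pos = count-other (λ w → dist? G v w 1) _≟ᶠ_ (allFin n) (allFin⁺ n)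
                                           (≤-trans (s≤s pos) (unsatisfied v))

  fewer-edges-satisfactory : (H : Digraph) → numEdges H < numEdges G → Σ (V H) (Satisfactory H)
  fewer-edges-satisfactory H fewer with any? (λ y → degOut H 1 y ≤? degOut H 2 y)
  ... | yes sat  = sat
  ... | no unsat = ⊥-elim (<⇒≱ fewer (proj₂ (proj₁ mc) H (λ y s → unsat (y , s))))

  deletion-satisfies-a-tail : {D : V G → V G → Set} (D? : ∀ a b → Dec (D a b)) → ∀ {a b} → Edge G a b → D a b →
      Σ (V G) (λ y → ¬ EdgeDeletion.Unaffected G D? y × Satisfactory (EdgeDeletion.G∖D G D?) y)
  deletion-satisfies-a-tail D? e d =
    let (y , sat) = fewer-edges-satisfactory G∖D (fewer-edges e d)
    in y , (λ unaffected → unaffected-unsatisfied y unaffected (proj₁ (proj₁ mc) y) sat) , sat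
    where open EdgeDeletion G D?

-- Only u is affected, so u becomes satisfactory in G − e:
--   |N₁(u)| ≤ 1 + |N₁^{G−e}(u)| ≤ 1 + |N₂^{G−e}(u)|.
-- Every second neighbour of u in G − e other than v is one in G, so at most
-- one second neighbour w of u is lost (w ∈ N₂(u), w ∉ N₂^{G−e}(u)), and none
-- is lost unless v ∈ N₂^{G−e}(u).
module OneEdge (G : Digraph) (mc : MinimalCriminal G) (u v : V G) (e : Edge G u v) where
  open Digraph G
  open Criminal G mc

  IsE : V G → V G → Set
  IsE a b = a ≡ u × b ≡ v

  isE? : ∀ a b → Dec (IsE a b)
  isE? a b = (a ≟ᶠ u) ×-dec (b ≟ᶠ v)

  open EdgeDeletion G isE? public
    using (Unaffected; remaining-edge; dist2-lift; degOut1-single-target) renaming (G∖D to G−e)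

  -- Only u loses an out-edge, so the satisfactory vertex of G − e is u.
  affected⇒u : ∀ y → ¬ Unaffected y → y ≡ u
  affected⇒u y affected with y ≟ᶠ u
  ... | yes y≡u = y≡u
  ... | no y≢u  = ⊥-elim (affected (λ _ _ (y≡u , _) → y≢u y≡u))

  u-satisfied : Satisfactory G−e u
  u-satisfied = let (y , affected , sat) = deletion-satisfies-a-tail isE? e (refl , refl)
                in subst (Satisfactory G−e) (affected⇒u y affected) sat

  degOut1-bound : degOut G 1 u ≤ suc (degOut G−e 2 u)
  degOut1-bound = ≤-trans (degOut1-single-target u v (λ _ z≢v (_ , z≡v) → z≢v z≡v)) (s≤s u-satisfied)

  Dist2′? : ∀ w → Dec (Dist G−e u w 2)
  Dist2′? w = dist? G−e u w 2

  Dist2? : ∀ w → Dec (Dist G u w 2)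
  Dist2? w = dist? G u w 2

  Lost : V G → Set
  Lost w = Dist G u w 2 × ¬ Dist G−e u w 2

  lost? : ∀ w → Dec (Lost w)
  lost? w = Dist2? w ×-dec ¬? (Dist2′? w)

  returns : ℕ
  returns = count (λ w → Dist2′? w ×-dec (w ≟ᶠ v)) (allFin n)

  returns≤1 : returns ≤ 1
  returns≤1 = count-atMostOne _ v (allFin n) (allFin⁺ n) (λ _ → proj₂)

  returns≡0 : ¬ Dist G−e u v 2 → returns ≡ 0
  returns≡0 ¬d = count-none _ (allFin n) (All.tabulate (λ { _ (d , refl) → ¬d d }))

  kept lost : ℕ
  kept = count (λ w → Dist2? w ×-dec Dist2′? w) (allFin n)
  lost = count lost? (allFin n)

  degOut2′≤ : degOut G−e 2 u ≤ returns + kept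
  degOut2′≤ = begin
      degOut G−e 2 u
        ≡⟨ count-split Dist2′? (λ w → w ≟ᶠ v) (allFin n) ⟩
      returns + count (λ w → Dist2′? w ×-dec ¬? (w ≟ᶠ v)) (allFin n)
        ≤⟨ +-monoʳ-≤ returns (count-mono _ _ (λ w (d , w≢v) → dist2-lift (λ _ (_ , w≡v) → w≢v w≡v) d , d) (allFin n)) ⟩
      returns + kept ∎
    where open ≤-Reasoning

  degOut2≡ : degOut G 2 u ≡ kept + lost
  degOut2≡ = count-split Dist2? Dist2′? (allFin n)

  -- Combining: |N₂(u)| < |N₁(u)| ≤ 1 + returns + kept, so lost ≤ returns ≤ 1.
  lost≤returns : lost ≤ returns
  lost≤returns = +-cancelˡ-≤ kept lost returns (begin
      kept + lost ≡⟨ degOut2≡ ⟨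
      degOut G 2 u ≤⟨ ≤-pred (≤-trans (unsatisfied u) (≤-trans degOut1-bound (s≤s degOut2′≤))) ⟩
      returns + kept ≡⟨ +-comm returns kept ⟩
      kept + returns ∎)
    where open ≤-Reasoning

  degOut1≤2+degOut2 : degOut G 1 u ≤ 2 + degOut G 2 u
  degOut1≤2+degOut2 = ≤-trans degOut1-bound (s≤s (≤-trans degOut2′≤
    (+-mono-≤ returns≤1 (subst (kept ≤_) (sym degOut2≡) (m≤m+n kept lost)))))

  lost-unique : ∀ {y z} → Lost y → Lost z → y ≡ z
  lost-unique {y} {z} ly lz with y ≟ᶠ z
  ... | yes y≡z = y≡z
  ... | no y≢z  = ⊥-elim (1+n≰n (≤-trans (count-two lost? _≟ᶠ_ (∈-allFin y) (∈-allFin z) y≢z ly lz)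
                                          (≤-trans lost≤returns returns≤1)))

  nothing-lost : ¬ Dist G−e u v 2 → ∀ {w} → ¬ Lost w
  nothing-lost ¬d {w} lw = 1+n≰n (≤-trans (count-pos lost? (∈-allFin w) lw)
                                          (≤-trans lost≤returns (≤-reflexive (returns≡0 ¬d))))

  dist2′⇒avoiding : ∀ {w} → Dist G−e u w 2 → ShortPathAvoiding G u v u w
  dist2′⇒avoiding ((x , ux , _ , xw , refl) , shorter) =
    inj₂ (x , proj₁ (remaining-edge ux) , proj₁ (remaining-edge xw) ,
          proj₂ (remaining-edge ux) , proj₂ (remaining-edge xw) ,
          (λ { refl → noLoop u (proj₁ (remaining-edge ux)) }) ,
          (λ { refl → noLoop x (proj₁ (remaining-edge xw)) }) , shorter zero)

  unavoidable⇒lost : ∀ {w} → Dist G v w 1 → ¬ ShortPathAvoiding G u v u w → Lost w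
  unavoidable⇒lost {w} vw unavoidable =
    ((v , e , proj₁ vw) ,
      λ { zero       → λ { refl → noDigon u v e (dist1⇒edge G vw) }
        ; (suc zero) → λ { (_ , uw , refl) → unavoidable (inj₁ (uw , λ { (_ , refl) → noLoop v (dist1⇒edge G vw) })) } }) ,
    λ d → unavoidable (dist2′⇒avoiding d)

As-of-gap : ∀ k {a c} → a ≡ k + c → + a - + c ≡ + k
As-of-gap k {c = c} refl = trans ([+m]-[+n]≡m⊖n (k + c) c) (trans (⊖-≥ (m≤n+m c k)) (cong +_ (m+n∸n≡m k c)))

gap-1or2 : ∀ a c → c < a → a ≤ 2 + c → a ≡ 1 + c ⊎ a ≡ 2 + c
gap-1or2 a c c<a a≤2+c with a ≟ suc c
... | yes a≡1+c = inj₁ a≡1+c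
... | no a≢1+c  = inj₂ (≤-antisym a≤2+c (≤∧≢⇒< c<a (λ 1+c≡a → a≢1+c (sym 1+c≡a))))

∸-bound : ∀ a b x → a ≤ b → b + 1 ≤ x + a → b ∸ a + 1 ≤ x
∸-bound a b x a≤b h = +-cancelʳ-≤ a (b ∸ a + 1) x (begin
   b ∸ a + 1 + a   ≡⟨ +-assoc (b ∸ a) 1 a ⟩
   b ∸ a + (1 + a) ≡⟨ cong (λ z → b ∸ a + z) (+-comm 1 a) ⟩
   b ∸ a + (a + 1) ≡⟨ +-assoc (b ∸ a) a 1 ⟨
   b ∸ a + a + 1   ≡⟨ cong (_+ 1) (m∸n+n≡m a≤b) ⟩
   b + 1           ≤⟨ h ⟩
   x + a           ∎)
  where open ≤-Reasoning

-- (2): every vertex has anti-satisfaction 1 or 2, since |N₁(u)| ≤ 2 + |N₂(u)|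
-- by deleting any out-edge of u.
module AntiSatisfaction (G : Digraph) (mc : MinimalCriminal G) where
  open Criminal G mc

  gap : ∀ u → degOut G 1 u ≡ 1 + degOut G 2 u ⊎ degOut G 1 u ≡ 2 + degOut G 2 u
  gap u = let (v , uv) = outNeighbour u in
    gap-1or2 _ _ (unsatisfied u) (OneEdge.degOut1≤2+degOut2 G mc u v (dist1⇒edge G uv))

  As-1or2 : ∀ u → As G u ≡ + 1 ⊎ As G u ≡ + 2
  As-1or2 u = map⊎ (As-of-gap 1) (As-of-gap 2) (gap u)

-- (3): the vertices of {v} ∪ N₁(v) unreachable from u by short paths avoiding
-- e are lost second neighbours (or v itself, which forces none to be lost),
-- and at most one second neighbour is lost.
unavoidable-unique : (G : Digraph) → MinimalCriminal G →
    ∀ u v → Edge G u v → ∀ w w′ →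
    (w ≡ v ⊎ Nout G 1 v w) → (w′ ≡ v ⊎ Nout G 1 v w′) →
    ¬ ShortPathAvoiding G u v u w → ¬ ShortPathAvoiding G u v u w′ → w ≡ w′
unavoidable-unique G mc u v e w w′ = cases
  where
    open OneEdge G mc u v e
    cases : (w ≡ v ⊎ Nout G 1 v w) → (w′ ≡ v ⊎ Nout G 1 v w′) →
            ¬ ShortPathAvoiding G u v u w → ¬ ShortPathAvoiding G u v u w′ → w ≡ w′
    cases (inj₁ refl) (inj₁ refl) _   _    = refl
    cases (inj₁ refl) (inj₂ vw′)  ¬uv ¬uw′ = ⊥-elim (nothing-lost (¬uv ∘ dist2′⇒avoiding) (unavoidable⇒lost vw′ ¬uw′))
    cases (inj₂ vw)   (inj₁ refl) ¬uw ¬uv  = ⊥-elim (nothing-lost (¬uv ∘ dist2′⇒avoiding) (unavoidable⇒lost vw ¬uw))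
    cases (inj₂ vw)   (inj₂ vw′)  ¬uw ¬uw′ = lost-unique (unavoidable⇒lost vw ¬uw) (unavoidable⇒lost vw′ ¬uw′)

-- Every out-neighbour w of v is a triangle apex (u → w), or is
-- rerouted (w ∈ N₂(u) in G − e, giving a diamond u → c → w), or is lost.
-- Since at most one vertex is lost this yields a triangle or diamond, and
-- counting the three classes against |N₁(u)| gives the bounds of (5).
module EdgeBases (G : Digraph) (mc : MinimalCriminal G) (u v : V G) (e : Edge G u v) where
  open Digraph G
  open Criminal G mc
  open OneEdge G mc u v e

  TriangleOrDiamond : Set
  TriangleOrDiamond = Σ (V G) (TriangleApex G u v) ⊎ IsDiamondBase G u v

  Rerouted : V G → Set
  Rerouted w = Dist G v w 1 × Dist G u w 2 × Dist G−e u w 2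

  rerouted? : ∀ w → Dec (Rerouted w)
  rerouted? w = dist? G v w 1 ×-dec (Dist2? w ×-dec Dist2′? w)

  dist2-via-v : ∀ {w} → Dist G v w 1 → ¬ Edge G u w → Dist G u w 2
  dist2-via-v vw ¬uw = (v , e , proj₁ vw) ,
    λ { zero → λ { refl → noDigon u v e (dist1⇒edge G vw) } ; (suc zero) → λ { (_ , uw , refl) → ¬uw uw } }

  trichotomy : ∀ w → Dist G v w 1 → TriangleApex G u v w ⊎ (Rerouted w ⊎ Lost w)
  trichotomy w vw = decide (edge? G u w) (Dist2′? w)
    where
      decide : Dec (Edge G u w) → Dec (Dist G−e u w 2) → TriangleApex G u v w ⊎ (Rerouted w ⊎ Lost w)
      decide (yes uw) _         = inj₁ (edge⇒dist1 G uw , vw)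
      decide (no ¬uw) (yes d′) = inj₂ (inj₁ (vw , dist2-via-v vw ¬uw , d′))
      decide (no ¬uw) (no ¬d′) = inj₂ (inj₂ (dist2-via-v vw ¬uw , ¬d′))

  -- The avoiding path u → c → w of a rerouted w closes a diamond with base (u,v).
  rerouted⇒diamond : ∀ {w} → Rerouted w → Σ (V G) (λ c → Diamond G u v c w)
  rerouted⇒diamond {w} (vw , d2 , d′) with dist2′⇒avoiding d′
  ... | inj₁ (uw , _) = ⊥-elim (proj₂ d2 (suc zero) (w , uw , refl))
  ... | inj₂ (c , uc , cw , uc≢e , _ , u≢c , c≢w , u≢w) =
    c , e , dist1⇒edge G vw , uc , cw , (λ { refl → noLoop u e }) , u≢c , u≢w ,
    (λ v≡c → uc≢e (refl , sym v≡c)) , (λ { refl → noLoop v (dist1⇒edge G vw) }) , c≢w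

  classify : ∀ w → Dist G v w 1 → TriangleOrDiamond ⊎ Lost w
  classify w vw = [ (λ apex → inj₁ (inj₁ (w , apex))) ,
                    [ (λ r → let (c , diamond) = rerouted⇒diamond r in inj₁ (inj₂ (c , w , diamond))) , inj₂ ]′ ]′
                  (trichotomy w vw)

  -- If an out-neighbour y of v is lost, look one step further: either v → z for
  -- an out-neighbour z of y, or z ∈ N₂(v) and v has another out-neighbour.
  -- Either way a second out-neighbour of v exists, which cannot also be lost.
  beyond-lost : ∀ y → Dist G v y 1 → Lost y → ∀ z → Dist G y z 1 → Dec (Edge G v z) → TriangleOrDiamond
  beyond-lost y vy ly z yz (yes vz) =
    [ (λ r → r) , (λ lz → ⊥-elim (noLoop y (subst (Edge G y) (sym (lost-unique ly lz)) (dist1⇒edge G yz)))) ]′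
    (classify z (edge⇒dist1 G vz))
  beyond-lost y vy ly z yz (no ¬vz) =
    let (z′ , vz′ , z′≢y) = another-outNeighbour v (count-pos (λ w → dist? G v w 2) (∈-allFin z) vz) y
    in [ (λ r → r) , (λ lz′ → ⊥-elim (z′≢y (sym (lost-unique ly lz′)))) ]′ (classify z′ vz′)
    where
      vz : Dist G v z 2
      vz = (y , dist1⇒edge G vy , proj₁ yz) ,
        λ { zero → λ { refl → noDigon v y (dist1⇒edge G vy) (dist1⇒edge G yz) }
          ; (suc zero) → λ { (_ , vz , refl) → ¬vz vz } }

  triangle-or-diamond : TriangleOrDiamond
  triangle-or-diamond = let (y , vy) = outNeighbour v in
    [ (λ r → r) , (λ ly → let (z , yz) = outNeighbour y in beyond-lost y vy ly z yz (edge? G v z)) ]′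
    (classify y vy)

  a b t : ℕ
  a = degOut G 1 u
  b = degOut G 1 v
  t = numTriangles G u v

  N1u? : ∀ w → Dec (Dist G u w 1)
  N1u? w = dist? G u w 1

  v-not-apex : ¬ TriangleApex G u v v
  v-not-apex (_ , vv) = noLoop v (dist1⇒edge G vv)

  -- The apexes and v are distinct out-neighbours of u.
  1+t≤a : suc t ≤ a
  1+t≤a = count-strict (triangleApex? G u v) N1u? (λ _ → proj₁) (∈-allFin v) (edge⇒dist1 G e) v-not-apex

  -- If moreover u → x → v with x ≠ v, then x is a further out-neighbour of u.
  2+t≤a : ∀ x → Edge G u x → Edge G x v → x ≢ v → 2 + t ≤ a
  2+t≤a x ux xv x≢v = ≤-trans
      (s≤s (count-strict (triangleApex? G u v) Q? (λ _ → inj₁) (∈-allFin x) (inj₂ refl)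
                         (λ (_ , vx) → noDigon x v xv (dist1⇒edge G vx))))
      (count-strict Q? N1u? Q⇒N1u (∈-allFin v) (edge⇒dist1 G e) [ v-not-apex , (λ v≡x → x≢v (sym v≡x)) ]′)
    where
      Q? : ∀ w → Dec (TriangleApex G u v w ⊎ w ≡ x)
      Q? w = triangleApex? G u v w ⊎-dec (w ≟ᶠ x)
      Q⇒N1u : ∀ w → TriangleApex G u v w ⊎ w ≡ x → Dist G u w 1
      Q⇒N1u w (inj₁ apex) = proj₁ apex
      Q⇒N1u w (inj₂ refl) = edge⇒dist1 G ux

  -- If v ∈ N₂^{G−e}(u) it is so via some u → x → v with x ≠ v.
  t+returns<a : t + returns + 1 ≤ a
  t+returns<a = by-v (Dist2′? v)
    where
      open ≤-Reasoning
      by-v : Dec (Dist G−e u v 2) → t + returns + 1 ≤ a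
      by-v (no ¬d) = begin
        t + returns + 1 ≡⟨ cong (λ r → t + r + 1) (returns≡0 ¬d) ⟩
        t + 0 + 1       ≡⟨ cong (_+ 1) (+-identityʳ t) ⟩
        t + 1           ≡⟨ +-comm t 1 ⟩
        suc t           ≤⟨ 1+t≤a ⟩
        a               ∎
      by-v (yes ((x , ux , _ , xv , refl) , _)) = begin
        t + returns + 1 ≤⟨ +-monoˡ-≤ 1 (+-monoʳ-≤ t returns≤1) ⟩
        t + 1 + 1       ≡⟨ +-assoc t 1 1 ⟩
        t + 2           ≡⟨ +-comm t 2 ⟩
        2 + t           ≤⟨ 2+t≤a x (proj₁ (remaining-edge ux)) (proj₁ (remaining-edge xv))
                               (λ x≡v → proj₂ (remaining-edge ux) (refl , x≡v)) ⟩
        a               ∎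

  b≤t+degOut2 : b ≤ t + degOut G 2 u
  b≤t+degOut2 = count-union (λ w → dist? G v w 1) (triangleApex? G u v) Dist2?
    (λ w vw → map⊎ (λ apex → apex) [ (λ r → proj₁ (proj₂ r)) , proj₁ ]′ (trichotomy w vw)) (allFin n)

  b≤t+rerouted+lost : b ≤ t + (count rerouted? (allFin n) + lost)
  b≤t+rerouted+lost = ≤-trans
    (count-union (λ w → dist? G v w 1) (triangleApex? G u v) (λ w → rerouted? w ⊎-dec lost? w) trichotomy (allFin n))
    (+-monoʳ-≤ t (count-union (λ w → rerouted? w ⊎-dec lost? w) rerouted? lost? (λ _ r → r) (allFin n)))

  -- Distinct rerouted vertices are tops of distinct diamonds.
  rerouted≤diamonds : count rerouted? (allFin n) ≤ numDiamonds G u v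
  rerouted≤diamonds = ≤-trans
    (count-mono rerouted? (λ w → Any.any? (λ c → diamond? G u v c w) (allFin n))
       (λ w r → let (c , diamond) = rerouted⇒diamond r in lose (∈-allFin c) diamond) (allFin n))
    (count-any≤sum (λ c w → diamond? G u v c w) (allFin n) (allFin n))

  -- (5): b + 1 ≤ t + a, and b + 1 ≤ #rerouted + a.
  triangles-bound : a ≤ b → b ∸ a + 1 ≤ t
  triangles-bound a≤b = ∸-bound a b t a≤b (begin
      b + 1                    ≤⟨ +-monoˡ-≤ 1 b≤t+degOut2 ⟩
      t + degOut G 2 u + 1     ≡⟨ +-assoc t _ 1 ⟩
      t + (degOut G 2 u + 1)   ≡⟨ cong (λ z → t + z) (+-comm _ 1) ⟩
      t + suc (degOut G 2 u)   ≤⟨ +-monoʳ-≤ t (unsatisfied u) ⟩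
      t + a                    ∎)
    where open ≤-Reasoning

  diamonds-bound : a ≤ b → b ∸ a + 1 ≤ numDiamonds G u v
  diamonds-bound a≤b = ≤-trans (∸-bound a b r a≤b (begin
      b + 1                   ≤⟨ +-monoˡ-≤ 1 (≤-trans b≤t+rerouted+lost (+-monoʳ-≤ t (+-monoʳ-≤ r lost≤returns))) ⟩
      t + (r + returns) + 1   ≡⟨ solve 3 (λ t r p → (t :+ (r :+ p)) :+ con 1 := r :+ ((t :+ p) :+ con 1)) refl t r returns ⟩
      r + (t + returns + 1)   ≤⟨ +-monoʳ-≤ r t+returns<a ⟩
      r + a                   ∎)) rerouted≤diamonds
    where
      open ≤-Reasoning
      open +-*-Solver
      r : ℕ
      r = count rerouted? (allFin n)

-- A minimal criminal has no proper nonempty vertex set S closed under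
-- out-edges: the subdigraph induced on S keeps every distance from its
-- vertices, so it lies in 𝒜 with at most as many edges and fewer vertices.
module ForwardClosed (G : Digraph) (mc : MinimalCriminal G) {S : V G → Set} (S? : Decidable S)
                     (closed : ∀ y z → S y → Edge G y z → S z) {s₀ s₁ : V G} (in-S : S s₀) (not-in-S : ¬ S s₁) where
  open Digraph G

  members : List (V G)
  members = filter S? (allFin n)

  k : ℕ
  k = length members

  embed : Fin k → V G
  embed = lookup members

  embed-in-S : ∀ i → S (embed i)
  embed-in-S i = proj₂ (∈-filter⁻ S? {xs = allFin n} (∈-lookup i))

  embed-injective : ∀ i j → embed i ≡ embed j → i ≡ j
  embed-injective = lookup-injective members (filter⁺ S? (allFin⁺ n))

  embed-onto : ∀ {y} → S y → Σ (Fin k) (λ i → embed i ≡ y)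
  embed-onto sy = let y∈ = ∈-filter⁺ S? (∈-allFin _) sy in index y∈ , sym (lookup-index y∈)

  G[S] : Digraph
  G[S] = record
    { n = k ; adj = λ i j → adj (embed i) (embed j) ; nonempty = count-pos S? (∈-allFin s₀) in-S
    ; noLoop = λ i → noLoop (embed i) ; noDigon = λ i j → noDigon (embed i) (embed j) }

  -- Walks starting in S stay in S, so walks of G between vertices of S are walks of G[S].
  walk-stays : ∀ j {x y} → S x → Walk G j x y → S y
  walk-stays zero    sx refl        = sx
  walk-stays (suc j) sx (_ , e , p) = walk-stays j (closed _ _ sx e) p

  walk-embed : ∀ j i i′ → Walk G[S] j i i′ → Walk G j (embed i) (embed i′)
  walk-embed zero    i i′ eq          = cong embed eq
  walk-embed (suc j) i i′ (w , e , p) = embed w , e , walk-embed j w i′ p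

  walk-restrict : ∀ j i i′ → Walk G j (embed i) (embed i′) → Walk G[S] j i i′
  walk-restrict zero    i i′ eq          = embed-injective i i′ eq
  walk-restrict (suc j) i i′ (w , e , p) with embed-onto (closed (embed i) w (embed-in-S i) e)
  ... | iw , refl = iw , e , walk-restrict j iw i′ p

  dist-embed : ∀ {i i′ d} → Dist G[S] i i′ d → Dist G (embed i) (embed i′) d
  dist-embed (p , shorter) = walk-embed _ _ _ p , λ j q → shorter j (walk-restrict _ _ _ q)

  dist-restrict : ∀ {i i′ d} → Dist G (embed i) (embed i′) d → Dist G[S] i i′ d
  dist-restrict (p , shorter) = walk-restrict _ _ _ p , λ j q → shorter j (walk-embed _ _ _ q)

  map-embed : map embed (allFin k) ≡ members
  map-embed = trans (map-tabulate (λ i → i) embed) (tabulate-lookup members)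

  count-embed : ∀ {Q : V G → Set} (Q? : Decidable Q) → (∀ y → Q y → S y) →
                count (λ i → Q? (embed i)) (allFin k) ≡ count Q? (allFin n)
  count-embed Q? Q⊆S = begin
      count (λ i → Q? (embed i)) (allFin k)  ≡⟨ count-map Q? embed (allFin k) ⟨
      count Q? (map embed (allFin k))        ≡⟨ cong (count Q?) map-embed ⟩
      count Q? members                       ≡⟨ count-filter Q? S? (allFin n) ⟩
      count (λ x → Q? x ×-dec S? x) (allFin n)
        ≡⟨ count-ext _ Q? (λ _ → proj₁) (λ x q → q , Q⊆S x q) (allFin n) ⟩
      count Q? (allFin n)                    ∎
    where open ≡-Reasoning

  degOut-embed : ∀ d i → degOut G[S] d i ≡ degOut G d (embed i)
  degOut-embed d i = trans
    (count-ext (λ i′ → dist? G[S] i i′ d) (λ i′ → dist? G (embed i) (embed i′) d)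
               (λ _ → dist-embed) (λ _ → dist-restrict) (allFin k))
    (count-embed (λ y → dist? G (embed i) y d) (λ y dd → walk-stays d (embed-in-S i) (proj₁ dd)))

  G[S]∈𝒜 : InA G[S]
  G[S]∈𝒜 i sat = proj₁ (proj₁ mc) (embed i) (subst₂ _≤_ (degOut-embed 1 i) (degOut-embed 2 i) sat)

  G[S]-edges : numEdges G[S] ≤ numEdges G
  G[S]-edges = begin
      numEdges G[S]
        ≤⟨ sum-mono _ (λ i → outdeg (embed i))
             (λ i → ≤-reflexive (count-embed (edge? G (embed i)) (λ y e → closed (embed i) y (embed-in-S i) e))) (allFin k) ⟩
      sum (map (λ i → outdeg (embed i)) (allFin k)) ≡⟨ cong sum (map-∘ (allFin k)) ⟩
      sum (map outdeg (map embed (allFin k)))      ≡⟨ cong (λ vs → sum (map outdeg vs)) map-embed ⟩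
      sum (map outdeg members)                     ≤⟨ sum-filter outdeg S? (allFin n) ⟩
      numEdges G ∎
    where
      open ≤-Reasoning
      outdeg : V G → ℕ
      outdeg y = card G (edge? G y)

  fewer-vertices : k < n
  fewer-vertices = subst (k <_) (length-tabulate (λ i → i)) (filter-notAll S? (allFin n) (lose (∈-allFin s₁) not-in-S))

  impossible : ⊥
  impossible = <⇒≱ fewer-vertices
    (proj₂ mc G[S] (G[S]∈𝒜 , λ H H∈𝒜 → ≤-trans G[S]-edges (proj₂ (proj₁ mc) H H∈𝒜)))

-- Vertices reachable from u by walks of length ≤ k.  These sets increase
-- with k inside a set of size n, so some level is closed under out-edges.
module Reachability (G : Digraph) (u : V G) where
  open Digraph G

  Within : ℕ → V G → Set
  Within k y = Σ (Fin (suc k)) (λ j → Walk G (toℕ j) u y)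

  within? : ∀ k → Decidable (Within k)
  within? k y = any? (λ j → walk? G (toℕ j) u y)

  within-suc : ∀ {k y} → Within k y → Within (suc k) y
  within-suc {y = y} (j , p) = inject₁ j , subst (λ m → Walk G m u y) (sym (toℕ-inject₁ j)) p

  walk-snoc : ∀ j {x y z} → Walk G j x y → Edge G y z → Walk G (suc j) x z
  walk-snoc zero    refl         e = _ , e , refl
  walk-snoc (suc j) (w , e₁ , p) e = w , e₁ , walk-snoc j p e

  within-step : ∀ {k y z} → Within k y → Edge G y z → Within (suc k) z
  within-step (j , p) e = suc j , walk-snoc (toℕ j) p e

  Stable : ℕ → Set
  Stable k = ∀ y → Within (suc k) y → Within k y

  -- While level k is not stable its count exceeds k, which the fuel bounds.
  stabilise : ∀ k (fuel : ℕ) → n ≤ fuel + k → suc k ≤ count (within? k) (allFin n) → Σ ℕ Stable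
  stabilise k zero n≤k big = ⊥-elim (1+n≰n (≤-trans big (≤-trans (count-allFin≤ (within? k)) n≤k)))
  stabilise k (suc fuel) n≤fuel+k big with any? (λ y → within? (suc k) y ×-dec ¬? (within? k y))
  ... | no none = k , λ y wy → decidable-stable (within? k y) (λ ¬wy → none (y , wy , ¬wy))
  ... | yes (y , new , not-old) =
        stabilise (suc k) fuel (subst (n ≤_) (sym (+-suc fuel k)) n≤fuel+k)
          (≤-trans (s≤s big) (count-strict (within? k) (within? (suc k)) (λ _ → within-suc) (∈-allFin y) new not-old))

  stable-level : Σ ℕ Stable
  stable-level = stabilise 0 n (≤-reflexive (sym (+-identityʳ n))) (count-pos (within? 0) (∈-allFin u) (zero , refl))

-- (1): the reachable set of any vertex is forward closed, hence everything.
strongly-connected : (G : Digraph) → MinimalCriminal G → StronglyConnected G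
strongly-connected G mc u v = from-level stable-level
  where
    open Reachability G u
    from-level : Σ ℕ Stable → ∃ λ k → Walk G k u v
    from-level (k , stable) = decide (within? k v)
      where
        decide : Dec (Within k v) → ∃ λ k → Walk G k u v
        decide (yes (j , p)) = toℕ j , p
        decide (no ¬reach)   = ⊥-elim (ForwardClosed.impossible G mc (within? k)
                                         (λ y z wy e → stable z (within-step wy e)) (zero , refl) ¬reach)

-- (6): delete all edges into u.  The satisfactory vertex y this creates is an
-- in-neighbour of u; if A_s(y) = 2 then y would remain unsatisfied, since it
-- loses only the out-neighbour u and no second neighbours.
module InNeighbour (G : Digraph) (mc : MinimalCriminal G) (u : V G) where
  open Digraph G
  open Criminal G mc

  IntoU : V G → V G → Set
  IntoU a b = b ≡ u

  intoU? : ∀ a b → Dec (IntoU a b)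
  intoU? a b = b ≟ᶠ u

  open EdgeDeletion G intoU?

  last-edge : ∀ k {y} → Walk G (suc k) y u → Σ (V G) (λ x → Edge G x u)
  last-edge zero    {y} (_ , e , refl) = y , e
  last-edge (suc k)     (_ , _ , p)    = last-edge k p

  -- The walk back to u from an out-neighbour of u ends in an edge into u.
  in-edge : Σ (V G) (λ x → Edge G x u)
  in-edge with outNeighbour u
  ... | y , uy with strongly-connected G mc y u
  ...   | zero  , refl = ⊥-elim (noLoop y (dist1⇒edge G uy))
  ...   | suc k , p    = last-edge k p

  -- Second neighbours in G∖D keep the deleted-free last edge, so none is new.
  degOut2-into : ∀ y → degOut G∖D 2 y ≤ degOut G 2 y
  degOut2-into y = degOut2-lift y (λ { w ((_ , _ , _ , xw , refl) , _) _ → proj₂ (remaining-edge xw) })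

  gap-2-impossible : ∀ y → Satisfactory G∖D y → degOut G 1 y ≢ 2 + degOut G 2 y
  gap-2-impossible y sat gap2 = 1+n≰n (begin
      2 + degOut G 2 y     ≡⟨ gap2 ⟨
      degOut G 1 y         ≤⟨ degOut1-single-target y u (λ _ z≢u → z≢u) ⟩
      suc (degOut G∖D 1 y) ≤⟨ s≤s (≤-trans sat (degOut2-into y)) ⟩
      1 + degOut G 2 y     ∎)
    where open ≤-Reasoning

  in-neighbour-As1 : Σ (V G) (λ v → Nin G 1 u v × As G v ≡ + 1)
  in-neighbour-As1 = let (y , affected , sat) = deletion-satisfies-a-tail intoU? (proj₂ in-edge) refl
                     in conclude y affected sat (edge? G y u) (AntiSatisfaction.gap G mc y)
    where
      conclude : ∀ y → ¬ Unaffected y → Satisfactory G∖D y → Dec (Edge G y u) →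
                 degOut G 1 y ≡ 1 + degOut G 2 y ⊎ degOut G 1 y ≡ 2 + degOut G 2 y →
                 Σ (V G) (λ v → Nin G 1 u v × As G v ≡ + 1)
      conclude y affected _ (no ¬yu) _ = ⊥-elim (affected (λ z yz z≡u → ¬yu (subst (Edge G y) z≡u yz)))
      conclude y _ _   (yes yu) (inj₁ gap1) = y , edge⇒dist1 G yu , As-of-gap 1 gap1
      conclude y _ sat (yes yu) (inj₂ gap2) = ⊥-elim (gap-2-impossible y sat gap2)

-- (7): repeatedly prepend an in-neighbour with A_s = 1, given by (6), to a
-- path of distinct such vertices.  After at most n steps a vertex repeats,
-- and the part of the path up to the repetition is the required cycle.
module As1Cycle (G : Digraph) (mc : MinimalCriminal G) where
  open Digraph G

  As1 : V G → Set
  As1 w = As G w ≡ + 1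

  Cycle : Set
  Cycle = Σ (List (V G)) (λ c → IsCycle G c × All As1 c)

  prefix-all : {A : Set} {P : A → Set} → ∀ xs ys → All P (xs ++ ys) → All P xs
  prefix-all []       ys _          = []
  prefix-all (x ∷ xs) ys (px ∷ pxs) = px ∷ prefix-all xs ys pxs

  prefix-allPairs : {A : Set} {R : A → A → Set} → ∀ xs ys → AllPairs R (xs ++ ys) → AllPairs R xs
  prefix-allPairs []       ys _            = []
  prefix-allPairs (x ∷ xs) ys (rx ∷ rxs) = prefix-all xs ys rx ∷ prefix-allPairs xs ys rxs

  cut-at : ∀ {p x} → Edge G p x → ∀ y l → EdgesAlong G (y ∷ l) → p ∈ (y ∷ l) →
           Σ (List (V G)) λ c → EdgesAlong G (y ∷ c ++ x ∷ []) × Σ (List (V G)) (λ d → l ≡ c ++ d)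
  cut-at px y l       _          (here refl) = [] , (px , tt) , l , refl
  cut-at px y (z ∷ l) (yz , path) (there p∈) with cut-at px z l path p∈
  ... | c , path′ , d , refl = z ∷ c , (yz , path′) , d , refl

  close-cycle : ∀ {p x} → Edge G p x → ∀ rest → EdgesAlong G (x ∷ rest) → Unique (x ∷ rest) →
                All As1 (x ∷ rest) → p ∈ rest → Cycle
  close-cycle px (z ∷ l) (xz , path) uniq as1 p∈ with cut-at px z l path p∈
  ... | c , path′ , d , refl = (_ ∷ z ∷ c) , (prefix-allPairs (_ ∷ z ∷ c) d uniq , s≤s z≤n , (xz , path′)) ,
                               prefix-all (_ ∷ z ∷ c) d as1

  _∈?_ : (y : V G) (l : List (V G)) → Dec (y ∈ l)
  y ∈? l = Any.any? (y ≟ᶠ_) l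

  -- Invariant: x ∷ rest is a path of distinct vertices with A_s = 1, and the
  -- fuel plus its length exceeds n.
  grow : (fuel : ℕ) → ∀ x rest → EdgesAlong G (x ∷ rest) → Unique (x ∷ rest) → All As1 (x ∷ rest) →
         n < fuel + length (x ∷ rest) → Cycle
  grow fuel x rest path uniq as1 bound =
    let (p , px , p-As1) = InNeighbour.in-neighbour-As1 G mc x
    in extend fuel bound (dist1⇒edge G px) p-As1 (p ∈? (x ∷ rest))
    where
      extend : (fuel : ℕ) → n < fuel + length (x ∷ rest) → ∀ {p} → Edge G p x → As1 p → Dec (p ∈ (x ∷ rest)) → Cycle
      extend _ _ px _ (yes (here refl)) = ⊥-elim (noLoop x px)
      extend _ _ px _ (yes (there p∈))  = close-cycle px rest path uniq as1 p∈
      extend zero       bound px p-As1 (no p∉) = ⊥-elim (<⇒≱ bound (unique-length≤ (x ∷ rest) uniq))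
      extend (suc fuel) bound px p-As1 (no p∉) =
        grow fuel _ (x ∷ rest) (px , path) (¬Any⇒All¬ _ p∉ ∷ uniq) (p-As1 ∷ as1)
             (subst (n <_) (sym (+-suc fuel (length (x ∷ rest)))) bound)

  cycle : Cycle
  cycle = let (v , _ , v-As1) = InNeighbour.in-neighbour-As1 G mc (fromℕ< nonempty)
          in grow n v [] tt ([] ∷ []) (v-As1 ∷ []) (subst (n <_) (+-comm 1 n) (n<1+n n))

theorem3 : (G : Digraph) → MinimalCriminal G →
      StronglyConnected G
    × (∀ u → As G u ≡ + 1 ⊎ As G u ≡ + 2)
    × (∀ u v → Edge G u v → ∀ w w′ →
         (w ≡ v ⊎ Nout G 1 v w) → (w′ ≡ v ⊎ Nout G 1 v w′) →
         ¬ ShortPathAvoiding G u v u w → ¬ ShortPathAvoiding G u v u w′ → w ≡ w′)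
    × (∀ u v → Edge G u v → Σ (V G) (TriangleApex G u v) ⊎ IsDiamondBase G u v)
    × (∀ u v → Edge G u v → degOut G 1 u ≤ degOut G 1 v →
         (degOut G 1 v ∸ degOut G 1 u + 1 ≤ numTriangles G u v)
       × (degOut G 1 v ∸ degOut G 1 u + 1 ≤ numDiamonds G u v))
    × (∀ u → Σ (V G) (λ v → Nin G 1 u v × As G v ≡ + 1))
    × Σ (List (V G)) (λ c → IsCycle G c × All (λ w → As G w ≡ + 1) c)
theorem3 G mc =
    strongly-connected G mc
  , AntiSatisfaction.As-1or2 G mc
  , unavoidable-unique G mc
  , (λ u v e → EdgeBases.triangle-or-diamond G mc u v e)
  , (λ u v e a≤b → EdgeBases.triangles-bound G mc u v e a≤b , EdgeBases.diamonds-bound G mc u v e a≤b)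
  , InNeighbour.in-neighbour-As1 G mc
  , As1Cycle.cycle G mc
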